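{- The $\sqcap,\sqcup$-free fragment of $\mathbf{CL1}$ is exactly classical propositional logic; that is, a $\mathbf{CL1}$-formula containing no occurrences of $\sqcap$ or $\sqcup$ is provable in $\mathbf{CL1}$ if and only if it is a tautology of classical propositional logic.
   Context: $\mathbf{CL1}$ is the following propositional system. Its language extends that of classical propositional logic with two binary connectives $\sqcap$ (choice conjunction) and $\sqcup$ (choice disjunction). Atoms are either the two logical atoms $\top,\bot$ or infinitely many nonlogical atoms $p,q,r,\ldots$. $\mathbf{CL1}$-formulas are built from atoms with $\neg,\wedge,\vee,\rightarrow,\sqcap,\sqcup$, where $F\rightarrow G$ abbreviates $(\neg F)\vee G$. An occurrence of a subexpression is positive (resp. negative) if it is in the scope of an even (resp. odd) number of occurrences of $\neg$. A surface occurrence is one not in the scope of $\sqcap$ or $\sqcup$. An elementary formula is one containing no $\sqcap,\sqcup$, i.e. a formula of classical propositional logic. The elementarization of a formula $F$ is the result of replacing every surface occurrence of a subformula $G\sqcap H$ by $\top$ and every surface occurrence of a subformula $G\sqcup H$ by $\bot$. $F$ is stable iff its elementarization is a classical tautology. The rules of $\mathbf{CL1}$ (there are no separate axioms) are: Rule (a): from a set $\vec H$ of premises conclude a stable $F$, where whenever $F$ has a positive (resp. negative) surface occurrence of $G_1\sqcap G_2$ (resp. $G_1\sqcup G_2$), for each $i\in\{1,2\}$, $\vec H$ contains the result of replacing that occurrence in $F$ by $G_i$ ($\vec H$ may be empty). Rule (b): from $H$ conclude $F$, where $H$ is the result of replacing in $F$ a negative (resp. positive) surface occurrence of $G_1\sqcap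 G_2$ (resp. $G_1\sqcup G_2$) by $G_i$ for some $i\in\{1,2\}$. -}

module Defs where

open import Data.Nat using (ℕ)
open import Data.Bool using (Bool; true; false; not; _∧_; _∨_)
open import Data.Product using (_×_)
open import Relation.Binary.PropositionalEquality using (_≡_)

infixr 6 _∧ᶠ_ _⊓_
infixr 5 _∨ᶠ_ _⊔_
data Formula : Set where
  ⊤ᶠ ⊥ᶠ : Formula
  atom  : ℕ → Formula
  ¬ᶠ_   : Formula → Formula
  _∧ᶠ_ _∨ᶠ_ _⊓_ _⊔_ : Formula → Formula → Formula

_⇒ᶠ_ : Formula → Formula → Formula
F ⇒ᶠ G = (¬ᶠ F) ∨ᶠ G

data Elementary : Formula → Set where
  e⊤ : Elementary ⊤ᶠ
  e⊥ : Elementary ⊥ᶠ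
  eatom : ∀ n → Elementary (atom n)
  e¬ : ∀ {F} → Elementary F → Elementary (¬ᶠ F)
  e∧ : ∀ {F G} → Elementary F → Elementary G → Elementary (F ∧ᶠ G)
  e∨ : ∀ {F G} → Elementary F → Elementary G → Elementary (F ∨ᶠ G)

-- Surface contexts: one-hole contexts whose hole is not in the scope of ⊓ or ⊔.
data Ctx : Set where
  hole : Ctx
  ¬ᶜ   : Ctx → Ctx
  ∧ˡ   : Ctx → Formula → Ctx
  ∧ʳ   : Formula → Ctx → Ctx
  ∨ˡ   : Ctx → Formula → Ctx
  ∨ʳ   : Formula → Ctx → Ctx

plug : Ctx → Formula → Formula
plug hole      H = H
plug (¬ᶜ C)    H = ¬ᶠ (plug C H)
plug (∧ˡ C F)  H = plug C H ∧ᶠ F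
plug (∧ʳ F C)  H = F ∧ᶠ plug C H
plug (∨ˡ C F)  H = plug C H ∨ᶠ F
plug (∨ʳ F C)  H = F ∨ᶠ plug C H

positive : Ctx → Bool
positive hole      = true
positive (¬ᶜ C)    = not (positive C)
positive (∧ˡ C _)  = positive C
positive (∧ʳ _ C)  = positive C
positive (∨ˡ C _)  = positive C
positive (∨ʳ _ C)  = positive C

elem : Formula → Formula
elem ⊤ᶠ = ⊤ᶠ
elem ⊥ᶠ = ⊥ᶠ
elem (atom n) = atom n
elem (¬ᶠ F) = ¬ᶠ elem F
elem (F ∧ᶠ G) = elem F ∧ᶠ elem G
elem (F ∨ᶠ G) = elem F ∨ᶠ elem G
elem (F ⊓ G) = ⊤ᶠ
elem (F ⊔ G) = ⊥ᶠ

-- Classical truth evaluation under a valuation of nonlogical atoms.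
-- (Only applied to formulas without ⊓,⊔; the ⊓/⊔ clauses agree with elem.)
eval : (ℕ → Bool) → Formula → Bool
eval v ⊤ᶠ = true
eval v ⊥ᶠ = false
eval v (atom n) = v n
eval v (¬ᶠ F) = not (eval v F)
eval v (F ∧ᶠ G) = eval v F ∧ eval v G
eval v (F ∨ᶠ G) = eval v F ∨ eval v G
eval v (F ⊓ G) = true
eval v (F ⊔ G) = false

Tautology : Formula → Set
Tautology F = ∀ (v : ℕ → Bool) → eval v F ≡ true

Stable : Formula → Set
Stable F = Tautology (elem F)

data CL1⊢ : Formula → Set where
  ruleA : ∀ {F} → Stable F
        → (∀ C G₁ G₂ → positive C ≡ true → F ≡ plug C (G₁ ⊓ G₂)
             → CL1⊢ (plug C G₁) × CL1⊢ (plug C G₂))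
        → (∀ C G₁ G₂ → positive C ≡ false → F ≡ plug C (G₁ ⊔ G₂)
             → CL1⊢ (plug C G₁) × CL1⊢ (plug C G₂))
        → CL1⊢ F
  ruleB⊓₁ : ∀ C G₁ G₂ → positive C ≡ false → CL1⊢ (plug C G₁) → CL1⊢ (plug C (G₁ ⊓ G₂))
  ruleB⊓₂ : ∀ C G₁ G₂ → positive C ≡ false → CL1⊢ (plug C G₂) → CL1⊢ (plug C (G₁ ⊓ G₂))
  ruleB⊔₁ : ∀ C G₁ G₂ → positive C ≡ true → CL1⊢ (plug C G₁) → CL1⊢ (plug C (G₁ ⊔ G₂))
  ruleB⊔₂ : ∀ C G₁ G₂ → positive C ≡ true → CL1⊢ (plug C G₂) → CL1⊢ (plug C (G₁ ⊔ G₂))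

module Submission where

open import Defs
open import Data.Empty using (⊥-elim)
open import Relation.Nullary using (¬_)
open import Function.Bundles using (_⇔_; mk⇔; module Equivalence)
open import Relation.Binary.PropositionalEquality using (_≡_; refl; sym; cong; cong₂; subst)

-- On an elementary formula elementarization is the identity, so stability is
-- tautologicity; and an elementary formula has no surface ⊓ or ⊔, so rule (b)
-- never concludes it and rule (a) needs no premises for it.

elem-elementary : ∀ {F} → Elementary F → elem F ≡ F
elem-elementary e⊤        = refl
elem-elementary e⊥        = refl
elem-elementary (eatom n) = refl
elem-elementary (e¬ e)    = cong ¬ᶠ_ (elem-elementary e)
elem-elementary (e∧ e f)  = cong₂ _∧ᶠ_ (elem-elementary e) (elem-elementary f)
elem-elementary (e∨ e f)  = cong₂ _∨ᶠ_ (elem-elementary e) (elem-elementary f)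

Stable⇔Tautology : ∀ {F} → Elementary F → Stable F ⇔ Tautology F
Stable⇔Tautology e = mk⇔ (subst Tautology (elem-elementary e))
                         (subst Tautology (sym (elem-elementary e)))

plug-elementary⁻ : ∀ C {H} → Elementary (plug C H) → Elementary H
plug-elementary⁻ hole     e         = e
plug-elementary⁻ (¬ᶜ C)   (e¬ e)    = plug-elementary⁻ C e
plug-elementary⁻ (∧ˡ C _) (e∧ e _)  = plug-elementary⁻ C e
plug-elementary⁻ (∧ʳ _ C) (e∧ _ e)  = plug-elementary⁻ C e
plug-elementary⁻ (∨ˡ C _) (e∨ e _)  = plug-elementary⁻ C e
plug-elementary⁻ (∨ʳ _ C) (e∨ _ e)  = plug-elementary⁻ C e

plug-⊓-nonelementary : ∀ C {G₁ G₂} → ¬ Elementary (plug C (G₁ ⊓ G₂))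
plug-⊓-nonelementary C e with plug-elementary⁻ C e
... | ()

plug-⊔-nonelementary : ∀ C {G₁ G₂} → ¬ Elementary (plug C (G₁ ⊔ G₂))
plug-⊔-nonelementary C e with plug-elementary⁻ C e
... | ()

sound : ∀ {F} → CL1⊢ F → Elementary F → Tautology F
sound (ruleA stable _ _)  e = Equivalence.to (Stable⇔Tautology e) stable
sound (ruleB⊓₁ C _ _ _ _) e = ⊥-elim (plug-⊓-nonelementary C e)
sound (ruleB⊓₂ C _ _ _ _) e = ⊥-elim (plug-⊓-nonelementary C e)
sound (ruleB⊔₁ C _ _ _ _) e = ⊥-elim (plug-⊔-nonelementary C e)
sound (ruleB⊔₂ C _ _ _ _) e = ⊥-elim (plug-⊔-nonelementary C e)

complete : ∀ {F} → Elementary F → Tautology F → CL1⊢ F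
complete e taut = ruleA (Equivalence.from (Stable⇔Tautology e) taut)
  (λ C _ _ _ F≡ → ⊥-elim (plug-⊓-nonelementary C (subst Elementary F≡ e)))
  (λ C _ _ _ F≡ → ⊥-elim (plug-⊔-nonelementary C (subst Elementary F≡ e)))

proposition6p1 : ∀ (F : Formula) → Elementary F → (CL1⊢ F ⇔ Tautology F)
proposition6p1 _ e = mk⇔ (λ ⊢F → sound ⊢F e) (complete e)
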